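{- Let $n\ge 2$ with $n\neq 4,7$, and let $\mathbb{P}_n$ be the path on $n$ vertices. Then $\mathbb{P}_n$ is a compliant graph.
   Context: Let $G$ be a graph without isolated vertices. A total dominating set (TDS) of $G$ is a set $S\subseteq V(G)$ such that every vertex of $G$ (including those in $S$) is adjacent to some vertex of $S$. A TDS $S$ is a minimal TDS (MTDS) if no proper subset of $S$ is a TDS. A vertex $a$ of $G$ is compliant if there exists an MTDS of $G$ containing $a$; $G$ is a compliant graph if every vertex of $G$ is compliant. -}

module Defs where

open import Data.Nat using (ℕ; suc)
open import Data.Fin using (Fin; toℕ)
open import Data.Fin.Subset using (Subset; _∈_; _⊂_)
open import Data.Product using (∃; _×_; Σ)
open import Data.Sum using (_⊎_; inj₁; inj₂)
open import Data.Nat.Properties using (1+n≢n)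
open import Relation.Binary.PropositionalEquality using (_≡_)
open import Relation.Nullary using (¬_)

record Graph (n : ℕ) : Set₁ where
  field
    Adj       : Fin n → Fin n → Set
    irrefl    : ∀ v → ¬ Adj v v
    symmetric : ∀ {u v} → Adj u v → Adj v u

open Graph public

IsTDS : ∀ {n} → Graph n → Subset n → Set
IsTDS G S = ∀ v → ∃ λ u → u ∈ S × Adj G v u

IsMTDS : ∀ {n} → Graph n → Subset n → Set
IsMTDS {n} G S = IsTDS G S × (∀ (T : Subset n) → T ⊂ S → ¬ IsTDS G T)

Compliant : ∀ {n} → Graph n → Fin n → Set
Compliant {n} G a = Σ (Subset n) λ S → IsMTDS G S × a ∈ S

CompliantGraph : ∀ {n} → Graph n → Set
CompliantGraph G = ∀ a → Compliant G a

PathAdj : ∀ {n} → Fin n → Fin n → Set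
PathAdj i j = (suc (toℕ i) ≡ toℕ j) ⊎ (suc (toℕ j) ≡ toℕ i)

Path : (n : ℕ) → Graph n
Path n = record
  { Adj       = PathAdj
  ; irrefl    = λ v → λ { (inj₁ e) → 1+n≢n e
                        ; (inj₂ e) → 1+n≢n e }
  ; symmetric = λ { (inj₁ e) → inj₂ e ; (inj₂ e) → inj₁ e }
  }

{-# OPTIONS --safe #-}
module Submission where

-- A TDS in which every vertex has an open private neighbour (a vertex whose
-- only neighbour in the set is that vertex) is minimal.  On paths such sets
-- are built by prepending the blocks 110 and 0110 (1 = in the set) to one on
-- a shorter path: each block totally dominates itself, its members are
-- private neighbours of each other, and its last vertex lies outside the set,
-- so gluing destroys no private neighbour.  Prepending 110 to the sets
-- witnessing compliance of P_n covers every vertex of P_(n+3) except the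
-- third, which 0110 covers.  The small paths, and P_10 (P_7 being
-- excluded), are settled by exhaustive search.

open import Defs
open import Data.Nat as ℕ using (ℕ; zero; suc; _+_; _≤_; z≤n; s≤s)
open import Data.Nat.Properties using (suc-injective; +-cancelˡ-≡)
open import Data.Fin using (Fin; zero; suc; toℕ; fromℕ; _↑ˡ_; _↑ʳ_; _≟_)
open import Data.Fin.Properties using (all?; any?; toℕ-↑ˡ)
open import Data.Fin.Subset using (Subset; _∈_; _∉_; _⊆_; inside; outside)
open import Data.Fin.Subset.Properties using (_∈?_; anySubset?)
open import Data.Vec using ([]; _∷_; _++_; here; there)
open import Data.Product using (∃; _×_; _,_)
open import Data.Sum as Sum using (_⊎_; inj₁; inj₂; swap)
open import Data.Empty using (⊥-elim)
open import Function using (_∘_; id)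
open import Relation.Binary.PropositionalEquality using (_≡_; _≢_; refl; sym; cong; subst; subst₂)
open import Relation.Nullary using (¬_; Dec; yes; no; ¬?)
open import Relation.Nullary.Decidable using (True; toWitness; _×-dec_; _⊎-dec_; _→-dec_)

private
  variable
    n m b : ℕ

OpenPrivateNeighbour : Graph n → Subset n → Fin n → Fin n → Set
OpenPrivateNeighbour G S s v = Adj G v s × (∀ u → u ∈ S → Adj G v u → u ≡ s)

IsOpenIrredundant : Graph n → Subset n → Set
IsOpenIrredundant G S = ∀ s → s ∈ S → ∃ (OpenPrivateNeighbour G S s)

HasInternalPrivateNeighbours : Graph n → Subset n → Set
HasInternalPrivateNeighbours G S =
  ∀ s → s ∈ S → ∃ λ v → v ∈ S × OpenPrivateNeighbour G S s v

IsOpenIrredundantTDS : Graph n → Subset n → Set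
IsOpenIrredundantTDS G S = IsTDS G S × IsOpenIrredundant G S

IrredundantlyCompliant : Graph n → Fin n → Set
IrredundantlyCompliant {n} G a = ∃ λ (S : Subset n) → IsOpenIrredundantTDS G S × a ∈ S

openIrredundantTDS⇒MTDS : {G : Graph n} {S : Subset n} →
                          IsOpenIrredundantTDS G S → IsMTDS G S
openIrredundantTDS⇒MTDS {G = G} {S} (tds , irredundant) =
  tds , λ { T (T⊆S , s , s∈S , s∉T) → noTDS T T⊆S s s∈S s∉T }
  where
  noTDS : ∀ T → T ⊆ S → ∀ s → s ∈ S → s ∉ T → ¬ IsTDS G T
  noTDS T T⊆S s s∈S s∉T T-tds
    with v , _ , onlyS ← irredundant s s∈S
    with u , u∈T , v~u ← T-tds v
    = s∉T (subst (_∈ T) (onlyS u (T⊆S u∈T) v~u) u∈T)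

irredundantlyCompliant⇒compliant : {G : Graph n} {a : Fin n} →
                                   IrredundantlyCompliant G a → Compliant G a
irredundantlyCompliant⇒compliant {G = G} (S , oi , a∈S) =
  S , openIrredundantTDS⇒MTDS {G = G} oi , a∈S

module _ (G : Graph n) (adj? : ∀ u v → Dec (Adj G u v)) where

  isTDS? : ∀ S → Dec (IsTDS G S)
  isTDS? S = all? λ v → any? λ u → u ∈? S ×-dec adj? v u

  isOpenPrivateNeighbour? : ∀ S s v → Dec (OpenPrivateNeighbour G S s v)
  isOpenPrivateNeighbour? S s v =
    adj? v s ×-dec all? λ u → u ∈? S →-dec adj? v u →-dec u ≟ s

  isOpenIrredundantTDS? : ∀ S → Dec (IsOpenIrredundantTDS G S)
  isOpenIrredundantTDS? S =
    isTDS? S ×-dec all? λ s → s ∈? S →-dec any? (isOpenPrivateNeighbour? S s)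

  hasInternalPrivateNeighbours? : ∀ S → Dec (HasInternalPrivateNeighbours G S)
  hasInternalPrivateNeighbours? S =
    all? λ s → s ∈? S →-dec any? λ v → v ∈? S ×-dec isOpenPrivateNeighbour? S s v

pathAdj? : (u v : Fin n) → Dec (PathAdj u v)
pathAdj? u v = (suc (toℕ u) ℕ.≟ toℕ v) ⊎-dec (suc (toℕ v) ℕ.≟ toℕ u)

PathAdj-transport : {i j : Fin m} {i′ j′ : Fin n} →
                    toℕ i ≡ toℕ i′ → toℕ j ≡ toℕ j′ → PathAdj i j → PathAdj i′ j′
PathAdj-transport = subst₂ λ x y → suc x ≡ y ⊎ suc y ≡ x

PathAdj-↑ˡ⁺ : {i j : Fin m} → PathAdj i j → PathAdj (i ↑ˡ n) (j ↑ˡ n)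
PathAdj-↑ˡ⁺ {n = n} {i = i} {j = j} =
  PathAdj-transport (sym (toℕ-↑ˡ i n)) (sym (toℕ-↑ˡ j n))

PathAdj-↑ˡ⁻ : {i j : Fin m} → PathAdj (i ↑ˡ n) (j ↑ˡ n) → PathAdj i j
PathAdj-↑ˡ⁻ {n = n} {i = i} {j = j} = PathAdj-transport (toℕ-↑ˡ i n) (toℕ-↑ˡ j n)

PathAdj-suc⁺ : {i j : Fin n} → PathAdj i j → PathAdj (suc i) (suc j)
PathAdj-suc⁺ = Sum.map (cong suc) (cong suc)

PathAdj-suc⁻ : {i j : Fin n} → PathAdj (suc i) (suc j) → PathAdj i j
PathAdj-suc⁻ = Sum.map suc-injective suc-injective

PathAdj-↑ʳ⁺ : ∀ m {i j : Fin n} → PathAdj i j → PathAdj (m ↑ʳ i) (m ↑ʳ j)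
PathAdj-↑ʳ⁺ zero    = id
PathAdj-↑ʳ⁺ (suc m) = PathAdj-suc⁺ ∘ PathAdj-↑ʳ⁺ m

PathAdj-↑ʳ⁻ : ∀ m {i j : Fin n} → PathAdj (m ↑ʳ i) (m ↑ʳ j) → PathAdj i j
PathAdj-↑ʳ⁻ zero    = id
PathAdj-↑ʳ⁻ (suc m) = PathAdj-↑ʳ⁻ m ∘ PathAdj-suc⁻

PathAdj-↑ˡ-↑ʳ : ∀ b {i : Fin (suc b)} {j : Fin n} →
                PathAdj (i ↑ˡ n) (suc b ↑ʳ j) → i ≡ fromℕ b
PathAdj-↑ˡ-↑ʳ zero    {zero}  _        = refl
PathAdj-↑ˡ-↑ʳ (suc b) {zero}  (inj₁ ())
PathAdj-↑ˡ-↑ʳ (suc b) {zero}  (inj₂ ())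
PathAdj-↑ˡ-↑ʳ (suc b) {suc i} i~j = cong suc (PathAdj-↑ˡ-↑ʳ b (PathAdj-suc⁻ i~j))

data SplitView (m n : ℕ) : Fin (m + n) → Set where
  left  : (i : Fin m) → SplitView m n (i ↑ˡ n)
  right : (j : Fin n) → SplitView m n (m ↑ʳ j)

splitView : ∀ m (i : Fin (m + n)) → SplitView m n i
splitView zero    j       = right j
splitView (suc m) zero    = left zero
splitView (suc m) (suc i) with splitView m i
... | left i  = left (suc i)
... | right j = right j

∈-++⁺ˡ : {T : Subset m} {S : Subset n} {i : Fin m} → i ∈ T → i ↑ˡ n ∈ T ++ S
∈-++⁺ˡ here      = here
∈-++⁺ˡ (there p) = there (∈-++⁺ˡ p)

∈-++⁻ˡ : (T : Subset m) {S : Subset n} {i : Fin m} → i ↑ˡ n ∈ T ++ S → i ∈ T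
∈-++⁻ˡ (_ ∷ _) {i = zero}  here      = here
∈-++⁻ˡ (_ ∷ T) {i = suc i} (there p) = there (∈-++⁻ˡ T p)

∈-++⁺ʳ : (T : Subset m) {S : Subset n} {j : Fin n} → j ∈ S → m ↑ʳ j ∈ T ++ S
∈-++⁺ʳ []      p = p
∈-++⁺ʳ (_ ∷ T) p = there (∈-++⁺ʳ T p)

∈-++⁻ʳ : (T : Subset m) {S : Subset n} {j : Fin n} → m ↑ʳ j ∈ T ++ S → j ∈ S
∈-++⁻ʳ []      p         = p
∈-++⁻ʳ (_ ∷ T) (there p) = ∈-++⁻ʳ T p

++-isTDS : {T : Subset m} {S : Subset n} →
           IsTDS (Path m) T → IsTDS (Path n) S → IsTDS (Path (m + n)) (T ++ S)
++-isTDS {m = m} {n} {T} T-tds S-tds p with splitView m p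
... | left i  = let u , u∈T , i~u = T-tds i in u ↑ˡ n , ∈-++⁺ˡ u∈T , PathAdj-↑ˡ⁺ i~u
... | right j = let u , u∈S , j~u = S-tds j in m ↑ʳ u , ∈-++⁺ʳ T u∈S , PathAdj-↑ʳ⁺ m j~u

module _ {T : Subset (suc b)} {S : Subset n} (last∉T : fromℕ b ∉ T) where

  privateNeighbour-↑ˡ : ∀ {s v} → v ∈ T → OpenPrivateNeighbour (Path (suc b)) T s v →
                        OpenPrivateNeighbour (Path (suc b + n)) (T ++ S) (s ↑ˡ n) (v ↑ˡ n)
  privateNeighbour-↑ˡ {s = s} {v} v∈T (v~s , onlyS) = PathAdj-↑ˡ⁺ v~s , only
    where
    only : ∀ u → u ∈ T ++ S → PathAdj (v ↑ˡ n) u → u ≡ s ↑ˡ n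
    only u u∈ v~u with splitView (suc b) u
    ... | left w  = cong (_↑ˡ n) (onlyS w (∈-++⁻ˡ T u∈) (PathAdj-↑ˡ⁻ v~u))
    ... | right w = ⊥-elim (last∉T (subst (_∈ T) (PathAdj-↑ˡ-↑ʳ b v~u) v∈T))

  privateNeighbour-↑ʳ : ∀ {s v} → OpenPrivateNeighbour (Path n) S s v →
                        OpenPrivateNeighbour (Path (suc b + n)) (T ++ S)
                                             (suc b ↑ʳ s) (suc b ↑ʳ v)
  privateNeighbour-↑ʳ {s = s} {v} (v~s , onlyS) = PathAdj-↑ʳ⁺ (suc b) v~s , only
    where
    only : ∀ u → u ∈ T ++ S → PathAdj (suc b ↑ʳ v) u → u ≡ suc b ↑ʳ s
    only u u∈ v~u with splitView (suc b) u
    ... | left w  =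
      ⊥-elim (last∉T (subst (_∈ T) (PathAdj-↑ˡ-↑ʳ b (swap v~u)) (∈-++⁻ˡ T u∈)))
    ... | right w = cong (suc b ↑ʳ_) (onlyS w (∈-++⁻ʳ T u∈) (PathAdj-↑ʳ⁻ (suc b) v~u))

  ++-isOpenIrredundant : HasInternalPrivateNeighbours (Path (suc b)) T →
                         IsOpenIrredundant (Path n) S →
                         IsOpenIrredundant (Path (suc b + n)) (T ++ S)
  ++-isOpenIrredundant T-int S-oi p p∈ with splitView (suc b) p
  ... | left i  = let v , v∈T , pn = T-int i (∈-++⁻ˡ T p∈)
                  in  v ↑ˡ n , privateNeighbour-↑ˡ v∈T pn
  ... | right j = let v , pn = S-oi j (∈-++⁻ʳ T p∈)
                  in  suc b ↑ʳ v , privateNeighbour-↑ʳ pn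

IsPathBlock : Subset (suc b) → Set
IsPathBlock {b} T =
  IsTDS (Path (suc b)) T × HasInternalPrivateNeighbours (Path (suc b)) T × fromℕ b ∉ T

isPathBlock? : (T : Subset (suc b)) → Dec (IsPathBlock T)
isPathBlock? {b} T = isTDS? (Path (suc b)) pathAdj? T
             ×-dec hasInternalPrivateNeighbours? (Path (suc b)) pathAdj? T
             ×-dec ¬? (fromℕ b ∈? T)

prependBlock : {T : Subset (suc b)} {S : Subset n} → IsPathBlock T →
               IsOpenIrredundantTDS (Path n) S →
               IsOpenIrredundantTDS (Path (suc b + n)) (T ++ S)
prependBlock (T-tds , T-int , last∉T) (S-tds , S-oi) =
  ++-isTDS T-tds S-tds , ++-isOpenIrredundant last∉T T-int S-oi

block-110 : IsPathBlock (inside ∷ inside ∷ outside ∷ [])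
block-110 = toWitness {a? = isPathBlock? _} _

block-0110 : IsPathBlock (outside ∷ inside ∷ inside ∷ outside ∷ [])
block-0110 = toWitness {a? = isPathBlock? _} _

openIrredundantTDS-bySearch :
  {found : True (anySubset? (isOpenIrredundantTDS? (Path n) pathAdj?))} →
  ∃ (IsOpenIrredundantTDS (Path n))
openIrredundantTDS-bySearch {found = found} = toWitness found

irredundantlyCompliant-bySearch :
  {found : True (all? λ a → anySubset? λ S →
                   isOpenIrredundantTDS? (Path n) pathAdj? S ×-dec a ∈? S)} →
  ∀ a → IrredundantlyCompliant (Path n) a
irredundantlyCompliant-bySearch {found = found} = toWitness found

path-openIrredundantTDS : ∀ n → ∃ (IsOpenIrredundantTDS (Path (2 + n)))
path-openIrredundantTDS 0 = openIrredundantTDS-bySearch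
path-openIrredundantTDS 1 = openIrredundantTDS-bySearch
path-openIrredundantTDS 2 = openIrredundantTDS-bySearch
path-openIrredundantTDS (suc (suc (suc n))) =
  let _ , S-oi = path-openIrredundantTDS n in _ , prependBlock block-110 S-oi

path-irredundantlyCompliant-+3 : (∀ a → IrredundantlyCompliant (Path (3 + n)) a) →
                            ∀ a → IrredundantlyCompliant (Path (6 + n)) a
path-irredundantlyCompliant-+3 compliant zero =
  let _ , S-oi , _ = compliant zero in _ , prependBlock block-110 S-oi , here
path-irredundantlyCompliant-+3 compliant (suc zero) =
  let _ , S-oi , _ = compliant zero in _ , prependBlock block-110 S-oi , there here
path-irredundantlyCompliant-+3 {n} _ (suc (suc zero)) =
  let _ , S-oi = path-openIrredundantTDS n in
  _ , prependBlock block-0110 S-oi , there (there here)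
path-irredundantlyCompliant-+3 compliant (suc (suc (suc a))) =
  let _ , S-oi , a∈S = compliant a in
  _ , prependBlock block-110 S-oi , there (there (there a∈S))

path-irredundantlyCompliant : ∀ n → 2 ≤ n → n ≢ 4 → n ≢ 7 →
                             ∀ a → IrredundantlyCompliant (Path n) a
path-irredundantlyCompliant 1 (s≤s ())
path-irredundantlyCompliant 2 _ _ _ = irredundantlyCompliant-bySearch
path-irredundantlyCompliant 3 _ _ _ = irredundantlyCompliant-bySearch
path-irredundantlyCompliant 4 _ 4≢4 _ = ⊥-elim (4≢4 refl)
path-irredundantlyCompliant 5 _ _ _ = irredundantlyCompliant-bySearch
path-irredundantlyCompliant (suc (suc (suc (suc (suc (suc n)))))) _ _ 6+n≢7
  with n ℕ.≟ 4 | path-irredundantlyCompliant (3 + n) (s≤s (s≤s z≤n)) (6+n≢7 ∘ cong (3 +_))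
... | yes refl | _             = irredundantlyCompliant-bySearch
... | no n≢4   | 3+n-compliant =
  path-irredundantlyCompliant-+3 (3+n-compliant (n≢4 ∘ +-cancelˡ-≡ 3 n 4))

theorem3 : (n : ℕ) → 2 ≤ n → n ≢ 4 → n ≢ 7 → CompliantGraph (Path n)
theorem3 n 2≤n n≢4 n≢7 a =
  irredundantlyCompliant⇒compliant {G = Path n} (path-irredundantlyCompliant n 2≤n n≢4 n≢7 a)
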